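{- A position $(n_0,n_1,n_2,n_3,n_4,n_5)$ of ${\rm ECN}(6_{\{1,3\}},2)$ is a $\mathcal{P}$-position if and only if $n_0\oplus n_2\oplus n_4 = n_1\oplus n_3\oplus n_5 = 0$.
   Context: Extended circular nim ${\rm ECN}(m_S,k)$ (positive integers $k\le m$, $S$ a set of positive integers each at most $m/2$): there are $m$ piles $v_0,\dots,v_{m-1}$ arranged in a circle (indices mod $m$); a position is a tuple $(n_0,\dots,n_{m-1})$ of nonnegative integers, $n_i$ being the number of tokens on $v_i$. A move chooses $s\in S$, $i\in\{0,\dots,m-1\}$, $j\in\{0,\dots,k-1\}$ and removes an arbitrary nonnegative number of tokens from each pile $v_{(i+ts)\bmod m}$, $t=0,\dots,j$, removing at least one token in total (empty piles still count as piles). Normal play: the player unable to move loses. A $\mathcal{P}$-position is a position from which the previous player (the player who just moved) has a winning strategy. $\oplus$ denotes bitwise exclusive OR (nim-sum). -}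

module Defs where

open import Data.Nat using (ℕ; zero; suc; _+_; _*_; _≤_; _<_; NonZero)
open import Data.Nat.DivMod using (_%_; _/_)
open import Data.Fin using (Fin; toℕ)
open import Data.List using (List; _∷_; [])
open import Data.List.Membership.Propositional using (_∈_)
open import Data.Product using (Σ; ∃; _×_; _,_)
open import Relation.Binary.PropositionalEquality using (_≡_)

-- Bitwise exclusive OR (nim-sum) on ℕ, computed bit by bit.
-- The fuel argument (a + b) is always sufficient: each step halves both inputs.
xorFuel : ℕ → ℕ → ℕ → ℕ
xorFuel zero    a b = 0
xorFuel (suc f) a b = ((a % 2) + (b % 2)) % 2 + 2 * xorFuel f (a / 2) (b / 2)

infixl 6 _⊕_
_⊕_ : ℕ → ℕ → ℕ
a ⊕ b = xorFuel (a + b) a b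

Position : ℕ → Set
Position m = Fin m → ℕ

InChain : (m : ℕ) .{{_ : NonZero m}} → ℕ → Fin m → ℕ → Fin m → Set
InChain m s i j l = Σ ℕ λ t → (t ≤ j) × (toℕ l ≡ (toℕ i + t * s) % m)

ECNMove : (m : ℕ) .{{_ : NonZero m}} → List ℕ → ℕ → Position m → Position m → Set
ECNMove m S k p q =
  Σ ℕ λ s → (s ∈ S) × Σ (Fin m) λ i → Σ ℕ λ j → (j < k) ×
    ((∀ l → InChain m s i j l → q l ≤ p l) ×
     (∀ l → (InChain m s i j l → Data.Empty.⊥) → q l ≡ p l) ×
     (∃ λ l → q l < p l))
  where import Data.Empty

mutual
  data IsP (m : ℕ) .{{_ : NonZero m}} (S : List ℕ) (k : ℕ) (p : Position m) : Set where
    isP : (∀ q → ECNMove m S k p q → IsN m S k q) → IsP m S k p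

  data IsN (m : ℕ) .{{_ : NonZero m}} (S : List ℕ) (k : ℕ) (p : Position m) : Set where
    isN : ∀ q → ECNMove m S k p q → IsP m S k q → IsN m S k p

{-# OPTIONS --safe #-}
-- The steps 1 and 3 are odd and the circle has even length, so a chain
-- v_i, v_(i+s) meets each parity class {v₀, v₂, v₄}, {v₁, v₃, v₅} at most once,
-- and conversely every even pile shares such a chain with every odd pile. Hence
-- the game is two three-heap Nim games in which a move plays in one or both.
-- By Bouton's argument, a move from a position where both nim-sums vanish makes
-- one of them nonzero, while from any other position a single move makes both
-- vanish. So these positions form an independent, absorbing set (the kernel)
-- of the finite game graph, and that set is exactly the set of P-positions.
module Submission where

open import Defs
open import Data.Bool.Base using (Bool; true; false; _xor_)
open import Data.Bool.Properties using (xor-comm; xor-assoc; xor-same; xor-identityʳ)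
open import Data.Empty using (⊥-elim)
open import Data.Fin.Base using (Fin; zero; suc; toℕ; combine; remQuot; punchIn)
open import Data.Fin using (#_)
open import Data.Fin.Patterns using (0F; 1F; 2F; 3F; 4F; 5F)
open import Data.Fin.Properties
  using (_≟_; toℕ<n; toℕ-injective; toℕ-combine; remQuot-combine; combine-surjective;
         combine-injective; punchInᵢ≢i; all?; ¬∀⟶∃¬)
open import Data.List.Base using (List; _∷_; [])
open import Data.List.Membership.Propositional using (_∈_)
open import Data.List.Relation.Unary.Any using (here; there)
open import Data.Nat.Base
open import Data.Nat.Properties hiding (_≟_)
import Data.Nat.Properties as ℕ
open import Data.Nat.DivMod
open import Data.Nat.Divisibility using (_∣_; divides; m∣m*n)
open import Data.Nat.Induction using (<-wellFounded)
open import Data.Product using (∃; ∃₂; _×_; _,_; proj₁; proj₂; uncurry)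
open import Data.Sum using (_⊎_; inj₁; inj₂) renaming (map to ⊎-map)
open import Data.Vec.Functional using (updateAt)
open import Data.Vec.Functional.Properties using (updateAt-updates; updateAt-minimal)
open import Function.Base using (_∘_; const; flip)
open import Function.Bundles using (_⇔_; mk⇔)
open import Function.Construct.Composition using (_⇔-∘_)
open import Induction.WellFounded using (Acc; acc)
open import Relation.Binary.PropositionalEquality
open import Relation.Nullary using (¬_; yes; no)
open import Relation.Unary using (Decidable)

infixr 7 _◂_

_◂_ : Bool → ℕ → ℕ
false ◂ n = 2 * n
true  ◂ n = suc (2 * n)

binary-view : ∀ n → ∃₂ λ b h → b ◂ h ≡ n
binary-view zero = false , 0 , refl
binary-view (suc n) with binary-view n
... | false , h , refl = true , h , refl
... | true  , h , refl = false , suc h , cong suc (+-suc h (h + 0))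

◂-%2 : ∀ b n → (b ◂ n) % 2 ≡ b ◂ 0
◂-%2 false n = %-remove-+ʳ 0 {d = 2} (m∣m*n n)
◂-%2 true  n = %-remove-+ʳ 1 {d = 2} (m∣m*n n)

◂-/2 : ∀ b n → (b ◂ n) / 2 ≡ n
◂-/2 false n = trans (/-congˡ (*-comm 2 n)) (m*n/n≡m n 2)
◂-/2 true  n = trans (+-distrib-/-∣ʳ 1 {d = 2} (m∣m*n n)) (◂-/2 false n)

2*m≤1+n⇒m≤n : ∀ m {n} → 2 * m ≤ suc n → m ≤ n
2*m≤1+n⇒m≤n zero    _        = z≤n
2*m≤1+n⇒m≤n (suc m) (s≤s le) =
  ≤-trans (m≤n+m (suc m) m) (subst (λ k → m + suc k ≤ _) (+-identityʳ m) le)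

halves-≤ : ∀ a b {f} → a + b ≤ suc f → a / 2 + b / 2 ≤ f
halves-≤ a b {f} a+b≤ = 2*m≤1+n⇒m≤n (a / 2 + b / 2) (begin
  2 * (a / 2 + b / 2)       ≡⟨ *-distribˡ-+ 2 (a / 2) (b / 2) ⟩
  2 * (a / 2) + 2 * (b / 2) ≤⟨ +-mono-≤ (twice-half≤ a) (twice-half≤ b) ⟩
  a + b                     ≤⟨ a+b≤ ⟩
  suc f                     ∎)
  where
  open ≤-Reasoning
  twice-half≤ : ∀ n → 2 * (n / 2) ≤ n
  twice-half≤ n = subst (_≤ n) (*-comm (n / 2) 2) (m/n*n≤m n 2)

xorFuel-0-0 : ∀ f → xorFuel f 0 0 ≡ 0
xorFuel-0-0 zero    = refl
xorFuel-0-0 (suc f) = cong (2 *_) (xorFuel-0-0 f)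

xorFuel-stable : ∀ f g {a b} → a + b ≤ f → a + b ≤ g → xorFuel f a b ≡ xorFuel g a b
xorFuel-stable zero g {a} a+b≤0 _
  with refl ← m+n≡0⇒m≡0 a (n≤0⇒n≡0 a+b≤0) | refl ← m+n≡0⇒n≡0 a (n≤0⇒n≡0 a+b≤0)
  = sym (xorFuel-0-0 g)
xorFuel-stable (suc f) zero {a} _ a+b≤0
  with refl ← m+n≡0⇒m≡0 a (n≤0⇒n≡0 a+b≤0) | refl ← m+n≡0⇒n≡0 a (n≤0⇒n≡0 a+b≤0)
  = xorFuel-0-0 (suc f)
xorFuel-stable (suc f) (suc g) {a} {b} a+b≤f a+b≤g =
  cong (λ h → (a % 2 + b % 2) % 2 + 2 * h)
       (xorFuel-stable f g (halves-≤ a b a+b≤f) (halves-≤ a b a+b≤g))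

⊕-unfold : ∀ a b → a ⊕ b ≡ (a % 2 + b % 2) % 2 + 2 * (a / 2 ⊕ b / 2)
⊕-unfold a b = begin
  xorFuel (a + b) a b       ≡⟨ xorFuel-stable (a + b) (suc (a + b)) ≤-refl (n≤1+n _) ⟩
  xorFuel (suc (a + b)) a b ≡⟨ cong (λ h → (a % 2 + b % 2) % 2 + 2 * h)
                                    (xorFuel-stable (a + b) (a / 2 + b / 2) (halves-≤ a b (n≤1+n _)) ≤-refl) ⟩
  (a % 2 + b % 2) % 2 + 2 * (a / 2 ⊕ b / 2) ∎
  where open ≡-Reasoning

◂-⊕ : ∀ x y a b → (x ◂ a) ⊕ (y ◂ b) ≡ (x xor y) ◂ (a ⊕ b)
◂-⊕ x y a b = begin
  (x ◂ a) ⊕ (y ◂ b)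
    ≡⟨ ⊕-unfold (x ◂ a) (y ◂ b) ⟩
  ((x ◂ a) % 2 + (y ◂ b) % 2) % 2 + 2 * ((x ◂ a) / 2 ⊕ (y ◂ b) / 2)
    ≡⟨ cong₂ (λ u v → (u + v) % 2 + 2 * ((x ◂ a) / 2 ⊕ (y ◂ b) / 2)) (◂-%2 x a) (◂-%2 y b) ⟩
  (x ◂ 0 + y ◂ 0) % 2 + 2 * ((x ◂ a) / 2 ⊕ (y ◂ b) / 2)
    ≡⟨ cong₂ (λ u v → (x ◂ 0 + y ◂ 0) % 2 + 2 * (u ⊕ v)) (◂-/2 x a) (◂-/2 y b) ⟩
  (x ◂ 0 + y ◂ 0) % 2 + 2 * (a ⊕ b)
    ≡⟨ low-bit x y ⟩
  (x xor y) ◂ (a ⊕ b) ∎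
  where
  open ≡-Reasoning
  low-bit : ∀ x y → (x ◂ 0 + y ◂ 0) % 2 + 2 * (a ⊕ b) ≡ (x xor y) ◂ (a ⊕ b)
  low-bit false false = refl
  low-bit false true  = refl
  low-bit true  false = refl
  low-bit true  true  = refl

binary-ind₃ : (P : ℕ → ℕ → ℕ → Set) → P 0 0 0 →
              (∀ x y z {a b c} → P a b c → P (x ◂ a) (y ◂ b) (z ◂ c)) →
              ∀ a b c → P a b c
binary-ind₃ P base step a b c =
  bounded (a + b + c) a b c (≤-trans (m≤m+n a b) (m≤m+n (a + b) c))
                            (≤-trans (m≤n+m b a) (m≤m+n (a + b) c)) (m≤n+m c (a + b))
  where
  ◂-≤-pred : ∀ x {h n} → x ◂ h ≤ suc n → h ≤ n
  ◂-≤-pred false le = 2*m≤1+n⇒m≤n _ le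
  ◂-≤-pred true  le = 2*m≤1+n⇒m≤n _ (≤-trans (n≤1+n _) le)
  bounded : ∀ n a b c → a ≤ n → b ≤ n → c ≤ n → P a b c
  bounded zero a b c a≤0 b≤0 c≤0
    rewrite n≤0⇒n≡0 a≤0 | n≤0⇒n≡0 b≤0 | n≤0⇒n≡0 c≤0 = base
  bounded (suc n) a b c a≤ b≤ c≤
    with x , a′ , refl ← binary-view a
       | y , b′ , refl ← binary-view b
       | z , c′ , refl ← binary-view c
    = step x y z (bounded n a′ b′ c′ (◂-≤-pred x a≤) (◂-≤-pred y b≤) (◂-≤-pred z c≤))

⊕-comm : ∀ a b → a ⊕ b ≡ b ⊕ a
⊕-comm a b = binary-ind₃ (λ a b _ → a ⊕ b ≡ b ⊕ a) refl step a b 0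
  where
  step : ∀ x y z {a b c : ℕ} → a ⊕ b ≡ b ⊕ a → (x ◂ a) ⊕ (y ◂ b) ≡ (y ◂ b) ⊕ (x ◂ a)
  step x y _ {a} {b} ih = begin
    (x ◂ a) ⊕ (y ◂ b) ≡⟨ ◂-⊕ x y a b ⟩
    (x xor y) ◂ (a ⊕ b) ≡⟨ cong₂ _◂_ (xor-comm x y) ih ⟩
    (y xor x) ◂ (b ⊕ a) ≡⟨ ◂-⊕ y x b a ⟨
    (y ◂ b) ⊕ (x ◂ a) ∎
    where open ≡-Reasoning

⊕-assoc : ∀ a b c → (a ⊕ b) ⊕ c ≡ a ⊕ (b ⊕ c)
⊕-assoc = binary-ind₃ (λ a b c → (a ⊕ b) ⊕ c ≡ a ⊕ (b ⊕ c)) refl step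
  where
  step : ∀ x y z {a b c} → (a ⊕ b) ⊕ c ≡ a ⊕ (b ⊕ c) →
         ((x ◂ a) ⊕ (y ◂ b)) ⊕ (z ◂ c) ≡ (x ◂ a) ⊕ ((y ◂ b) ⊕ (z ◂ c))
  step x y z {a} {b} {c} ih = begin
    ((x ◂ a) ⊕ (y ◂ b)) ⊕ (z ◂ c)   ≡⟨ cong (_⊕ (z ◂ c)) (◂-⊕ x y a b) ⟩
    ((x xor y) ◂ (a ⊕ b)) ⊕ (z ◂ c) ≡⟨ ◂-⊕ (x xor y) z (a ⊕ b) c ⟩
    ((x xor y) xor z) ◂ ((a ⊕ b) ⊕ c) ≡⟨ cong₂ _◂_ (xor-assoc x y z) ih ⟩
    (x xor (y xor z)) ◂ (a ⊕ (b ⊕ c)) ≡⟨ ◂-⊕ x (y xor z) a (b ⊕ c) ⟨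
    (x ◂ a) ⊕ ((y xor z) ◂ (b ⊕ c)) ≡⟨ cong ((x ◂ a) ⊕_) (◂-⊕ y z b c) ⟨
    (x ◂ a) ⊕ ((y ◂ b) ⊕ (z ◂ c))   ∎
    where open ≡-Reasoning

⊕-same : ∀ a → a ⊕ a ≡ 0
⊕-same a = binary-ind₃ (λ a _ _ → a ⊕ a ≡ 0) refl step a 0 0
  where
  step : ∀ x y z {a b c : ℕ} → a ⊕ a ≡ 0 → (x ◂ a) ⊕ (x ◂ a) ≡ 0
  step x _ _ {a} ih = trans (◂-⊕ x x a a) (cong₂ _◂_ (xor-same x) ih)

⊕-identityʳ : ∀ a → a ⊕ 0 ≡ a
⊕-identityʳ a = binary-ind₃ (λ a _ _ → a ⊕ 0 ≡ a) refl step a 0 0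
  where
  step : ∀ x y z {a b c : ℕ} → a ⊕ 0 ≡ a → (x ◂ a) ⊕ 0 ≡ x ◂ a
  step x _ _ {a} ih = trans (◂-⊕ x false a 0) (cong₂ _◂_ (xor-identityʳ x) ih)

⊕-identityˡ : ∀ a → 0 ⊕ a ≡ a
⊕-identityˡ a = trans (⊕-comm 0 a) (⊕-identityʳ a)

⊕≡0⇒≡ : ∀ {a b} → a ⊕ b ≡ 0 → a ≡ b
⊕≡0⇒≡ {a} {b} a⊕b≡0 = begin
  a             ≡⟨ ⊕-identityʳ a ⟨
  a ⊕ 0         ≡⟨ cong (a ⊕_) (⊕-same b) ⟨
  a ⊕ (b ⊕ b)   ≡⟨ ⊕-assoc a b b ⟨
  (a ⊕ b) ⊕ b   ≡⟨ cong (_⊕ b) a⊕b≡0 ⟩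
  0 ⊕ b         ≡⟨ ⊕-identityˡ b ⟩
  b             ∎
  where open ≡-Reasoning

◂-mono-< : ∀ x y {a b} → a < b → x ◂ a < y ◂ b
◂-mono-< x y {a} {b} a<b = begin-strict
  x ◂ a     ≤⟨ ≤true◂ x ⟩
  true ◂ a  <⟨ n<1+n _ ⟩
  2 + 2 * a ≡⟨ *-suc 2 a ⟨
  2 * suc a ≤⟨ *-monoʳ-≤ 2 a<b ⟩
  2 * b     ≤⟨ false◂≤ y ⟩
  y ◂ b     ∎
  where
  open ≤-Reasoning
  ≤true◂ : ∀ x → x ◂ a ≤ true ◂ a
  ≤true◂ false = n≤1+n _
  ≤true◂ true  = ≤-refl
  false◂≤ : ∀ y → false ◂ b ≤ y ◂ b
  false◂≤ false = ≤-refl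
  false◂≤ true  = n≤1+n _

Reducible : ℕ → ℕ → ℕ → Set
Reducible a b c = b ⊕ c < a ⊎ a ⊕ c < b ⊎ a ⊕ b < c

⊕≢0⇒reducible : ∀ a b c → a ⊕ b ⊕ c ≢ 0 → Reducible a b c
⊕≢0⇒reducible =
  binary-ind₃ (λ a b c → a ⊕ b ⊕ c ≢ 0 → Reducible a b c) (λ ne → ⊥-elim (ne refl)) step
  where
  high-bits< : ∀ x y z {a b c} → a ⊕ b < c → (x ◂ a) ⊕ (y ◂ b) < z ◂ c
  high-bits< x y z {a} {b} lt = subst (_< _) (sym (◂-⊕ x y a b)) (◂-mono-< (x xor y) z lt)
  low-bit< : ∀ x y a b {c} → x xor y ≡ false → a ⊕ b ≡ c → (x ◂ a) ⊕ (y ◂ b) < true ◂ c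
  low-bit< x y a b bits hs = subst (_< _) (sym (trans (◂-⊕ x y a b) (cong₂ _◂_ bits hs))) (n<1+n _)
  step : ∀ x y z {a b c} → (a ⊕ b ⊕ c ≢ 0 → Reducible a b c) →
         (x ◂ a) ⊕ (y ◂ b) ⊕ (z ◂ c) ≢ 0 → Reducible (x ◂ a) (y ◂ b) (z ◂ c)
  step x y z {a} {b} {c} ih ne with a ⊕ b ⊕ c ℕ.≟ 0
  ... | no ne′ = ⊎-map (high-bits< y z x) (⊎-map (high-bits< x z y) (high-bits< x y z)) (ih ne′)
  ... | yes e = lowest x y z (odd-parity (subst (_≢ 0) all-bits ne))
    where
    all-bits : (x ◂ a) ⊕ (y ◂ b) ⊕ (z ◂ c) ≡ ((x xor y) xor z) ◂ (a ⊕ b ⊕ c)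
    all-bits = trans (cong (_⊕ (z ◂ c)) (◂-⊕ x y a b)) (◂-⊕ (x xor y) z (a ⊕ b) c)
    odd-parity : ∀ {u} → u ◂ (a ⊕ b ⊕ c) ≢ 0 → u ≡ true
    odd-parity {false} nonzero = ⊥-elim (nonzero (cong (false ◂_) e))
    odd-parity {true}  _       = refl
    b⊕c≡a : b ⊕ c ≡ a
    b⊕c≡a = sym (⊕≡0⇒≡ (trans (sym (⊕-assoc a b c)) e))
    a⊕c≡b : a ⊕ c ≡ b
    a⊕c≡b = sym (⊕≡0⇒≡ (trans (sym (⊕-assoc b a c)) (trans (cong (_⊕ c) (⊕-comm b a)) e)))
    a⊕b≡c : a ⊕ b ≡ c
    a⊕b≡c = ⊕≡0⇒≡ e
    -- The high parts cancel, so a heap whose lowest bit is set can drop by one.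
    lowest : ∀ x y z → (x xor y) xor z ≡ true → Reducible (x ◂ a) (y ◂ b) (z ◂ c)
    lowest true  false false _ = inj₁ (low-bit< false false b c refl b⊕c≡a)
    lowest true  true  true  _ = inj₁ (low-bit< true true b c refl b⊕c≡a)
    lowest false true  false _ = inj₂ (inj₁ (low-bit< false false a c refl a⊕c≡b))
    lowest false false true  _ = inj₂ (inj₂ (low-bit< false false a b refl a⊕b≡c))
    lowest false false false ()
    lowest false true  true  ()
    lowest true  false true  ()
    lowest true  true  false ()

nimSum₃ : (Fin 3 → ℕ) → ℕ
nimSum₃ f = f 0F ⊕ f 1F ⊕ f 2F

others : Fin 3 → (Fin 3 → ℕ) → ℕ
others k f = f (punchIn k 0F) ⊕ f (punchIn k 1F)

nimSum₃-cong : ∀ {f g} → (∀ k → f k ≡ g k) → nimSum₃ f ≡ nimSum₃ g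
nimSum₃-cong f≗g = cong₂ _⊕_ (cong₂ _⊕_ (f≗g 0F) (f≗g 1F)) (f≗g 2F)

nimSum₃-split : ∀ k f → nimSum₃ f ≡ f k ⊕ others k f
nimSum₃-split 0F f = ⊕-assoc (f 0F) (f 1F) (f 2F)
nimSum₃-split 1F f = trans (cong (_⊕ f 2F) (⊕-comm (f 0F) (f 1F))) (⊕-assoc (f 1F) (f 0F) (f 2F))
nimSum₃-split 2F f = ⊕-comm (f 0F ⊕ f 1F) (f 2F)

others-cong : ∀ k {f g} → (∀ k′ → k′ ≢ k → f k′ ≡ g k′) → others k f ≡ others k g
others-cong k f≗g = cong₂ _⊕_ (f≗g _ (punchInᵢ≢i k 0F)) (f≗g _ (punchInᵢ≢i k 1F))

nimSum₃≡0⇒≡others : ∀ f k → nimSum₃ f ≡ 0 → f k ≡ others k f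
nimSum₃≡0⇒≡others f k sum≡0 = ⊕≡0⇒≡ (trans (sym (nimSum₃-split k f)) sum≡0)

nimSum₃≢0⇒reducible : ∀ {f} → nimSum₃ f ≢ 0 → ∃ λ k → others k f < f k
nimSum₃≢0⇒reducible {f} sum≢0 with ⊕≢0⇒reducible (f 0F) (f 1F) (f 2F) sum≢0
... | inj₁ lt        = 0F , lt
... | inj₂ (inj₁ lt) = 1F , lt
... | inj₂ (inj₂ lt) = 2F , lt

balancing-index : ∀ f → ∃ λ k → others k f ≤ f k × (nimSum₃ f ≢ 0 → others k f < f k)
balancing-index f with nimSum₃ f ℕ.≟ 0
... | yes sum≡0 = 0F , ≤-reflexive (sym (nimSum₃≡0⇒≡others f 0F sum≡0)) , λ sum≢0 → ⊥-elim (sum≢0 sum≡0)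
... | no  sum≢0 with k , lt ← nimSum₃≢0⇒reducible sum≢0 = k , <⇒≤ lt , const lt

rebalance : Fin 3 → (Fin 3 → ℕ) → Fin 3 → ℕ
rebalance k f = updateAt f k (const (others k f))

nimSum₃-rebalance : ∀ k f → nimSum₃ (rebalance k f) ≡ 0
nimSum₃-rebalance k f = begin
  nimSum₃ (rebalance k f)                       ≡⟨ nimSum₃-split k (rebalance k f) ⟩
  rebalance k f k ⊕ others k (rebalance k f)    ≡⟨ cong₂ _⊕_ (updateAt-updates k f)
                                                           (others-cong k {rebalance k f} {f} (λ k′ → updateAt-minimal k′ k f)) ⟩
  others k f ⊕ others k f                       ≡⟨ ⊕-same (others k f) ⟩
  0                                             ∎
  where open ≡-Reasoning

rebalance-≤ : ∀ k f → others k f ≤ f k → ∀ k′ → rebalance k f k′ ≤ f k′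
rebalance-≤ k f others≤ k′ with k′ ≟ k
... | yes refl = subst (_≤ f k) (sym (updateAt-updates k f)) others≤
... | no  k′≢k = ≤-reflexive (updateAt-minimal k′ k f k′≢k)

tokens : ∀ {m} → Position m → ℕ
tokens {zero}  _ = 0
tokens {suc m} p = p zero + tokens (p ∘ suc)

tokens-mono-≤ : ∀ {m} {p q : Position m} → (∀ l → q l ≤ p l) → tokens q ≤ tokens p
tokens-mono-≤ {zero}  _   = z≤n
tokens-mono-≤ {suc m} q≤p = +-mono-≤ (q≤p zero) (tokens-mono-≤ (q≤p ∘ suc))

tokens-mono-< : ∀ {m} {p q : Position m} → (∀ l → q l ≤ p l) →
               ∀ l → q l < p l → tokens q < tokens p
tokens-mono-< q≤p zero    q<p = +-mono-<-≤ q<p (tokens-mono-≤ (q≤p ∘ suc))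
tokens-mono-< q≤p (suc l) q<p = +-mono-≤-< (q≤p zero) (tokens-mono-< (q≤p ∘ suc) l q<p)

module _ {m : ℕ} .{{_ : NonZero m}} {S : List ℕ} {k : ℕ} where

  ECNMove⇒≤ : ∀ {p q} → ECNMove m S k p q → ∀ l → q l ≤ p l
  ECNMove⇒≤ {p} {q} (_ , _ , _ , _ , _ , lowered , unchanged , _) l with q l ≤? p l
  ... | yes q≤p = q≤p
  ... | no  q≰p = ⊥-elim (q≰p (≤-reflexive (unchanged l (q≰p ∘ lowered l))))

  ECNMove⇒tokens-< : ∀ {p q} → ECNMove m S k p q → tokens q < tokens p
  ECNMove⇒tokens-< move@(_ , _ , _ , _ , _ , _ , _ , l , q<p) =
    tokens-mono-< (ECNMove⇒≤ move) l q<p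

  IsP⇔kernel : {K : Position m → Set} → Decidable K →
               (∀ {p q} → K p → ECNMove m S k p q → ¬ K q) →
               (∀ p → ¬ K p → ∃ λ q → ECNMove m S k p q × K q) →
               ∀ p → IsP m S k p ⇔ K p
  IsP⇔kernel {K} K? independent absorbing p = mk⇔ IsP⇒K (K⇒IsP p (<-wellFounded (tokens p)))
    where
    mutual
      IsP⇒K : ∀ {p} → IsP m S k p → K p
      IsP⇒K {p} (isP next) with K? p
      ... | yes Kp = Kp
      ... | no ¬Kp with q , p→q , Kq ← absorbing p ¬Kp = ⊥-elim (IsN⇒¬K (next q p→q) Kq)

      IsN⇒¬K : ∀ {q} → IsN m S k q → ¬ K q
      IsN⇒¬K (isN r q→r Pr) Kq = independent Kq q→r (IsP⇒K Pr)

    K⇒IsP : ∀ p → Acc _<_ (tokens p) → K p → IsP m S k p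
    K⇒IsP p (acc smaller) Kp = isP λ q p→q →
      let r , q→r , Kr = absorbing q (independent Kp p→q)
      in isN r q→r (K⇒IsP r (smaller (<-trans (ECNMove⇒tokens-< q→r) (ECNMove⇒tokens-< p→q))) Kr)

module _ {m : ℕ} .{{_ : NonZero m}} (2∣m : 2 ∣ m) (s : ℕ) (s-odd : s % 2 ≡ 1) where

  parity-flip : ∀ n → (n + 0 * s) % m % 2 ≢ (n + 1 * s) % m % 2
  parity-flip n same = x+1%2≢x (n%2<2) (begin
    (n % 2 + 1) % 2          ≡⟨ cong (λ r → (n % 2 + r) % 2) (trans (cong (_% 2) (+-identityʳ s)) s-odd) ⟨
    (n % 2 + (1 * s) % 2) % 2 ≡⟨ %-distribˡ-+ n (1 * s) 2 ⟨
    (n + 1 * s) % 2           ≡⟨ m∣n⇒o%n%m≡o%m 2 m (n + 1 * s) 2∣m ⟨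
    (n + 1 * s) % m % 2       ≡⟨ same ⟨
    (n + 0 * s) % m % 2       ≡⟨ m∣n⇒o%n%m≡o%m 2 m (n + 0 * s) 2∣m ⟩
    (n + 0) % 2               ≡⟨ cong (_% 2) (+-identityʳ n) ⟩
    n % 2                     ∎)
    where
    open ≡-Reasoning
    n%2<2 : n % 2 < 2
    n%2<2 = m%n<n n 2
    x+1%2≢x : ∀ {x} → x < 2 → (x + 1) % 2 ≢ x
    x+1%2≢x {0} _ ()
    x+1%2≢x {1} _ ()
    x+1%2≢x {2+ _} (s≤s (s≤s ())) _

  chain-parity-injective : ∀ {i j l l′} → j < 2 → InChain m s i j l → InChain m s i j l′ →
                           toℕ l % 2 ≡ toℕ l′ % 2 → l ≡ l′
  chain-parity-injective _ (0 , _ , l≡) (0 , _ , l′≡) _ = toℕ-injective (trans l≡ (sym l′≡))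
  chain-parity-injective _ (1 , _ , l≡) (1 , _ , l′≡) _ = toℕ-injective (trans l≡ (sym l′≡))
  chain-parity-injective {i} _ (0 , _ , l≡) (1 , _ , l′≡) same =
    ⊥-elim (parity-flip (toℕ i) (trans (cong (_% 2) (sym l≡)) (trans same (cong (_% 2) l′≡))))
  chain-parity-injective {i} _ (1 , _ , l≡) (0 , _ , l′≡) same =
    ⊥-elim (parity-flip (toℕ i) (trans (cong (_% 2) (sym l′≡)) (trans (sym same) (cong (_% 2) l≡))))
  chain-parity-injective (s≤s (s≤s ())) (suc (suc _) , s≤s (s≤s _) , _) _ _
  chain-parity-injective (s≤s (s≤s ())) _ (suc (suc _) , s≤s (s≤s _) , _) _

Move : Position 6 → Position 6 → Set
Move = ECNMove 6 (1 ∷ 3 ∷ []) 2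

step-odd : ∀ {s} → s ∈ 1 ∷ 3 ∷ [] → s % 2 ≡ 1
step-odd (here refl)         = refl
step-odd (there (here refl)) = refl

-- pile c k is v_(2k+c), the k-th pile of parity class c.
pile : Fin 2 → Fin 3 → Fin 6
pile c k = combine k c

pile-parity : ∀ c k → toℕ (pile c k) % 2 ≡ toℕ c
pile-parity c k = begin
  toℕ (combine k c) % 2     ≡⟨ cong (_% 2) (toℕ-combine k c) ⟩
  (2 * toℕ k + toℕ c) % 2  ≡⟨ %-remove-+ˡ (toℕ c) {d = 2} (m∣m*n (toℕ k)) ⟩
  toℕ c % 2                ≡⟨ m<n⇒m%n≡m (toℕ<n c) ⟩
  toℕ c                    ∎
  where open ≡-Reasoning

chain-meets-class-once : ∀ {s i j c k k′} → s ∈ 1 ∷ 3 ∷ [] → j < 2 →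
                         InChain 6 s i j (pile c k) → InChain 6 s i j (pile c k′) → k ≡ k′
chain-meets-class-once {s} {i} {j} {c} {k} {k′} s∈S j<2 in-chain in-chain′ =
  proj₁ (combine-injective k c k′ c
    (chain-parity-injective (divides 3 refl) s (step-odd s∈S) {i} {j} j<2 in-chain in-chain′
      (trans (pile-parity c k) (sym (pile-parity c k′)))))

-- The odd pile lies one or three steps after the even one, or one step before it.
pair-chain : ∀ k₀ k₁ → ∃₂ λ s i → s ∈ 1 ∷ 3 ∷ [] ×
                                  InChain 6 s i 1 (pile 0F k₀) × InChain 6 s i 1 (pile 1F k₁)
pair-chain 0F 0F = 1 , 0F , here refl         , (0 , z≤n , refl) , (1 , s≤s z≤n , refl)
pair-chain 0F 1F = 3 , 0F , there (here refl) , (0 , z≤n , refl) , (1 , s≤s z≤n , refl)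
pair-chain 0F 2F = 1 , 5F , here refl         , (1 , s≤s z≤n , refl) , (0 , z≤n , refl)
pair-chain 1F 0F = 1 , 1F , here refl         , (1 , s≤s z≤n , refl) , (0 , z≤n , refl)
pair-chain 1F 1F = 1 , 2F , here refl         , (0 , z≤n , refl) , (1 , s≤s z≤n , refl)
pair-chain 1F 2F = 3 , 2F , there (here refl) , (0 , z≤n , refl) , (1 , s≤s z≤n , refl)
pair-chain 2F 0F = 3 , 1F , there (here refl) , (1 , s≤s z≤n , refl) , (0 , z≤n , refl)
pair-chain 2F 1F = 1 , 3F , here refl         , (1 , s≤s z≤n , refl) , (0 , z≤n , refl)
pair-chain 2F 2F = 1 , 4F , here refl         , (0 , z≤n , refl) , (1 , s≤s z≤n , refl)

pile-surjective : ∀ l → ∃₂ λ c k → pile c k ≡ l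
pile-surjective l with k , c , k,c≡l ← combine-surjective {3} {2} l = c , k , k,c≡l

fromClasses : (Fin 2 → Fin 3 → ℕ) → Position 6
fromClasses g = uncurry (flip g) ∘ remQuot 2

fromClasses-pile : ∀ g c k → fromClasses g (pile c k) ≡ g c k
fromClasses-pile g c k = cong (uncurry (flip g)) (remQuot-combine k c)

classSum : Position 6 → Fin 2 → ℕ
classSum p c = nimSum₃ (p ∘ pile c)

Balanced : Position 6 → Set
Balanced p = ∀ c → classSum p c ≡ 0

balanced? : Decidable Balanced
balanced? p = all? (λ c → classSum p c ℕ.≟ 0)

balanced-independent : ∀ {p q} → Balanced p → Move p q → ¬ Balanced q
balanced-independent {p} {q} p-bal (s , s∈S , i , j , j<2 , _ , unchanged , l , q<p) q-bal
  with c , k , refl ← pile-surjective l = <⇒≢ q<p (begin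
    q (pile c k)          ≡⟨ nimSum₃≡0⇒≡others (q ∘ pile c) k (q-bal c) ⟩
    others k (q ∘ pile c) ≡⟨ others-cong k agree-elsewhere ⟩
    others k (p ∘ pile c) ≡⟨ nimSum₃≡0⇒≡others (p ∘ pile c) k (p-bal c) ⟨
    p (pile c k)          ∎)
  where
  open ≡-Reasoning
  lowered-in-chain : ¬ ¬ InChain 6 s i j (pile c k)
  lowered-in-chain ∉ = <⇒≢ q<p (unchanged _ ∉)
  agree-elsewhere : ∀ k′ → k′ ≢ k → q (pile c k′) ≡ p (pile c k′)
  agree-elsewhere k′ k′≢k = unchanged _ λ ∈′ → lowered-in-chain λ ∈ →
    k′≢k (chain-meets-class-once {i = i} {j} s∈S j<2 ∈′ ∈)

balanced-absorbing : ∀ p → ¬ Balanced p → ∃ λ q → Move p q × Balanced q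
balanced-absorbing p unbalanced = q , move , q-bal
  where
  κ : Fin 2 → Fin 3
  κ c = proj₁ (balancing-index (p ∘ pile c))
  κ-lowers : ∀ c → others (κ c) (p ∘ pile c) ≤ p (pile c (κ c))
  κ-lowers c = proj₁ (proj₂ (balancing-index (p ∘ pile c)))
  κ-strict : ∀ c → classSum p c ≢ 0 → others (κ c) (p ∘ pile c) < p (pile c (κ c))
  κ-strict c = proj₂ (proj₂ (balancing-index (p ∘ pile c)))
  -- Rebalancing an already balanced class changes nothing, so one move along a
  -- chain through both chosen piles handles every unbalanced position.
  q : Position 6
  q = fromClasses λ c → rebalance (κ c) (p ∘ pile c)
  q-pile : ∀ c k → q (pile c k) ≡ rebalance (κ c) (p ∘ pile c) k
  q-pile = fromClasses-pile _
  q-bal : Balanced q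
  q-bal c = trans (nimSum₃-cong (q-pile c)) (nimSum₃-rebalance (κ c) (p ∘ pile c))
  q≤p : ∀ l → q l ≤ p l
  q≤p l with c , k , refl ← pile-surjective l =
    subst (_≤ p (pile c k)) (sym (q-pile c k)) (rebalance-≤ (κ c) (p ∘ pile c) (κ-lowers c) k)
  move : Move p q
  move with s , i , s∈S , in₀ , in₁ ← pair-chain (κ 0F) (κ 1F)
          | c₀ , c₀≢0 ← ¬∀⟶∃¬ 2 _ (λ c → classSum p c ℕ.≟ 0) unbalanced
    = s , s∈S , i , 1 , ≤-refl , (λ l _ → q≤p l) , unchanged , pile c₀ (κ c₀) , strict
    where
    chosen-in-chain : ∀ c → InChain 6 s i 1 (pile c (κ c))
    chosen-in-chain 0F = in₀
    chosen-in-chain 1F = in₁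
    unchanged : ∀ l → ¬ InChain 6 s i 1 l → q l ≡ p l
    unchanged l ∉ with c , k , refl ← pile-surjective l =
      trans (q-pile c k) (updateAt-minimal k (κ c) (p ∘ pile c) λ { refl → ∉ (chosen-in-chain c) })
    strict : q (pile c₀ (κ c₀)) < p (pile c₀ (κ c₀))
    strict = subst (_< p (pile c₀ (κ c₀)))
                   (sym (trans (q-pile c₀ (κ c₀)) (updateAt-updates (κ c₀) (p ∘ pile c₀))))
                   (κ-strict c₀ c₀≢0)

Balanced⇔classSums : ∀ p → Balanced p ⇔ (classSum p 0F ≡ 0 × classSum p 1F ≡ 0)
Balanced⇔classSums p =
  mk⇔ (λ bal → bal 0F , bal 1F) λ { (sum₀ , sum₁) 0F → sum₀ ; (sum₀ , sum₁) 1F → sum₁ }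

mainTheorem5 : (p : Position 6) →
    IsP 6 (1 ∷ 3 ∷ []) 2 p
      ⇔ ((p (# 0) ⊕ p (# 2) ⊕ p (# 4) ≡ 0) × (p (# 1) ⊕ p (# 3) ⊕ p (# 5) ≡ 0))
mainTheorem5 p = Balanced⇔classSums p ⇔-∘ IsP⇔kernel balanced? balanced-independent balanced-absorbing p
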